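{- For all formulae $A,B$, the formula $\top^*\land(A*B)\to A$ is provable in $LS_{PASL}+D$.
   Context: Formulae: built from propositional variables and constants $\top,\bot,\top^*$ using $\land,\to,*,-\!*$. Labels: countably infinite set $\mathcal{L}$ with distinguished $\epsilon$. Relational atoms: $(a,b\triangleright c)$, $a=b$, $a\neq b$. Sequents $\mathcal{G};\Gamma\vdash\Delta$: finite set $\mathcal{G}$ of relational atoms, finite sets $\Gamma,\Delta$ of labelled formulae $a:A$. $E(\mathcal{G})\vdash a=b$ iff $(a,b)$ is in the smallest equivalence relation on $\mathcal{L}$ containing all $(c,d)$ with $c=d\in\mathcal{G}$. $LS$ (no cut): $(id)$ $\mathcal{G};\Gamma,a:p\vdash b:p,\Delta$ if $E(\mathcal{G})\vdash a=b$; $(\bot L)$; $(\top R)$; $(\top^*R)$ $\mathcal{G};\Gamma\vdash a:\top^*,\Delta$ if $E(\mathcal{G})\vdash a=\epsilon$; $(NEq)$ closes $\mathcal{G};\Gamma\vdash\Delta$ if $a\neq b\in\mathcal{G}$ and $E(\mathcal{G})\vdash a=b$; $(\top^*L)$ from $\mathcal{G}\cup\{a=\epsilon\};\Gamma\vdash\Delta$ infer $\mathcal{G};\Gamma,a:\top^*\vdash\Delta$; standard $\land L,\land R,\to L,\to R$ at one label; $(*L)$ from $\mathcal{G}\cup\{(x,y\triangleright z)\};\Gamma,x:A,y:B\vdash\Delta$ infer $\mathcal{G};\Gamma,z:A*B\vdash\Delta$ ($x,y$ fresh); $(-\!*R)$ from $\mathcal{G}\cup\{(x,z\triangleright y)\};\Gamma,x:A\vdash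 y:B,\Delta$ infer $\mathcal{G};\Gamma\vdash z:A-\!*B,\Delta$ ($x,y$ fresh); $(*R)$ if $(x,y\triangleright z)\in\mathcal{G}$ and $E(\mathcal{G})\vdash z=w$, from $\mathcal{G};\Gamma\vdash x:A,w:A*B,\Delta$ and $\mathcal{G};\Gamma\vdash y:B,w:A*B,\Delta$ infer $\mathcal{G};\Gamma\vdash w:A*B,\Delta$; $(-\!*L)$ if $(x,w\triangleright y)\in\mathcal{G}$ and $E(\mathcal{G})\vdash z=w$, from $\mathcal{G};\Gamma,z:A-\!*B\vdash x:A,\Delta$ and $\mathcal{G};\Gamma,z:A-\!*B,y:B\vdash\Delta$ infer $\mathcal{G};\Gamma,z:A-\!*B\vdash\Delta$; $(EM)$ from $\mathcal{G}\cup\{a=b\};\Gamma\vdash\Delta$ and $\mathcal{G}\cup\{a\neq b\};\Gamma\vdash\Delta$ infer $\mathcal{G};\Gamma\vdash\Delta$. A frame axiom $\forall\vec x.(s_1=t_1\&\cdots\& s_p=t_p\& S_1\&\cdots\& S_k\Rightarrow\exists y_1..y_n.(T_1\&\cdots\& T_l))$ gives the structural rule: for a substitution $\theta$ of labels for $\vec x$ (fixing $\epsilon$) with each $S_i\theta\in\mathcal{G}$ and $E(\mathcal{G})\vdash s_i\theta=t_i\theta$, and distinct fresh labels $b_j\neq\epsilon$ with $\sigma=[b_j/y_j]$: from $\mathcal{G}\cup\{T_i\theta\sigma\}_i;\Gamma\vdash\Delta$ infer $\mathcal{G};\Gamma\vdash\Delta$. $LS_{PASL}$ = $LS$ plus rules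 for: (E) $y=\epsilon\&(x,y\triangleright z)\Rightarrow x=z$; (U) $(x,\epsilon\triangleright x)$; (Com) $(x,y\triangleright z)\Rightarrow(y,x\triangleright z)$; (A) $y=y'\&(u,y\triangleright x)\&(v,w\triangleright y')\Rightarrow\exists z.((z,w\triangleright x)\&(u,v\triangleright z))$; (P) $w=w'\&x=x'\&(w,x\triangleright y)\&(w',x'\triangleright z)\Rightarrow y=z$; (C) $x=x'\&z=z'\&(x,y\triangleright z)\&(x',w\triangleright z')\Rightarrow y=w$ (all variables universally quantified). $D$ is the rule synthesised from disjointness $\forall h_1,h_2,h_3.\ h_1=h_3\ \&\ (h_1,h_3\triangleright h_2)\Rightarrow h_1=\epsilon$, i.e. if $(x,y\triangleright z)\in\mathcal{G}$ and $E(\mathcal{G})\vdash x=y$, from $\mathcal{G}\cup\{x=\epsilon\};\Gamma\vdash\Delta$ infer $\mathcal{G};\Gamma\vdash\Delta$. A formula $F$ is provable if $\emptyset;\emptyset\vdash w:F$ has a finite derivation for a label $w\neq\epsilon$. -}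

module Defs where

open import Data.Nat using (ℕ; zero)
open import Data.List using (List; []; _∷_; _++_; concatMap)
open import Data.List.Membership.Propositional using (_∈_; _∉_)
open import Data.List.Relation.Binary.Subset.Propositional using (_⊆_)
open import Data.Product using (_×_; ∃; Σ-syntax)
open import Relation.Binary.PropositionalEquality using (_≡_)
open import Relation.Nullary using (¬_)

infixr 6 _∧ᶠ_
infixr 5 _✱_
infixr 4 _-✱_
infixr 3 _⇒_

data Formula : Set where
  var   : ℕ → Formula
  ⊤ᶠ    : Formula
  ⊥ᶠ    : Formula
  ⊤*    : Formula
  _∧ᶠ_  : Formula → Formula → Formula
  _⇒_   : Formula → Formula → Formula
  _✱_   : Formula → Formula → Formula
  _-✱_  : Formula → Formula → Formula

Label : Set
Label = ℕ

ε : Label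
ε = zero

-- Relational atoms (a , b ▷ c), a = b, a ≠ b
data RelAtom : Set where
  tern : Label → Label → Label → RelAtom
  eqₐ  : Label → Label → RelAtom
  neqₐ : Label → Label → RelAtom

record LFormula : Set where
  constructor _∶_
  field
    lab  : Label
    form : Formula

infix 2 _∶_

-- Finite sets are represented by lists; the derivability relation below is
-- closed under "same elements" (rule set-ext), so only the underlying sets matter.
SameSet : {A : Set} → List A → List A → Set
SameSet xs ys = (xs ⊆ ys) × (ys ⊆ xs)

data _⊢E_≐_ (G : List RelAtom) : Label → Label → Set where
  e-base  : ∀ {a b} → eqₐ a b ∈ G → G ⊢E a ≐ b
  e-refl  : ∀ {a} → G ⊢E a ≐ a
  e-sym   : ∀ {a b} → G ⊢E a ≐ b → G ⊢E b ≐ a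
  e-trans : ∀ {a b c} → G ⊢E a ≐ b → G ⊢E b ≐ c → G ⊢E a ≐ c

atomLabels : RelAtom → List Label
atomLabels (tern a b c) = a ∷ b ∷ c ∷ []
atomLabels (eqₐ a b)    = a ∷ b ∷ []
atomLabels (neqₐ a b)   = a ∷ b ∷ []

lfLabels : LFormula → List Label
lfLabels (a ∶ _) = a ∷ []

seqLabels : List RelAtom → List LFormula → List LFormula → List Label
seqLabels G Γ Δ = concatMap atomLabels G ++ concatMap lfLabels Γ ++ concatMap lfLabels Δ

Fresh : Label → List RelAtom → List LFormula → List LFormula → Set
Fresh x G Γ Δ = (x ∉ seqLabels G Γ Δ) × ¬ (x ≡ ε)

-- In each rule, the conclusion is the sequent in the
-- result type; "Γ , a:A" is rendered as (a ∶ A) ∷ Γ.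

data LSPASLD : List RelAtom → List LFormula → List LFormula → Set where
  set-ext : ∀ {G G' Γ Γ' Δ Δ'} → SameSet G G' → SameSet Γ Γ' → SameSet Δ Δ' →
            LSPASLD G' Γ' Δ' → LSPASLD G Γ Δ
  id    : ∀ {G Γ Δ a b p} → G ⊢E a ≐ b →
          LSPASLD G ((a ∶ var p) ∷ Γ) ((b ∶ var p) ∷ Δ)
  ⊥L    : ∀ {G Γ Δ a} → LSPASLD G ((a ∶ ⊥ᶠ) ∷ Γ) Δ
  ⊤R    : ∀ {G Γ Δ a} → LSPASLD G Γ ((a ∶ ⊤ᶠ) ∷ Δ)
  ⊤*R   : ∀ {G Γ Δ a} → G ⊢E a ≐ ε → LSPASLD G Γ ((a ∶ ⊤*) ∷ Δ)
  NEq   : ∀ {G Γ Δ a b} → neqₐ a b ∈ G → G ⊢E a ≐ b → LSPASLD G Γ Δ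
  ⊤*L   : ∀ {G Γ Δ a} → LSPASLD (eqₐ a ε ∷ G) Γ Δ → LSPASLD G ((a ∶ ⊤*) ∷ Γ) Δ
  ∧L    : ∀ {G Γ Δ a A B} → LSPASLD G ((a ∶ A) ∷ (a ∶ B) ∷ Γ) Δ →
          LSPASLD G ((a ∶ A ∧ᶠ B) ∷ Γ) Δ
  ∧R    : ∀ {G Γ Δ a A B} → LSPASLD G Γ ((a ∶ A) ∷ Δ) → LSPASLD G Γ ((a ∶ B) ∷ Δ) →
          LSPASLD G Γ ((a ∶ A ∧ᶠ B) ∷ Δ)
  ⇒L    : ∀ {G Γ Δ a A B} → LSPASLD G Γ ((a ∶ A) ∷ Δ) → LSPASLD G ((a ∶ B) ∷ Γ) Δ →
          LSPASLD G ((a ∶ A ⇒ B) ∷ Γ) Δ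
  ⇒R    : ∀ {G Γ Δ a A B} → LSPASLD G ((a ∶ A) ∷ Γ) ((a ∶ B) ∷ Δ) →
          LSPASLD G Γ ((a ∶ A ⇒ B) ∷ Δ)
  ✱L    : ∀ {G Γ Δ x y z A B} →
          Fresh x G ((z ∶ A ✱ B) ∷ Γ) Δ → Fresh y G ((z ∶ A ✱ B) ∷ Γ) Δ → ¬ (x ≡ y) →
          LSPASLD (tern x y z ∷ G) ((x ∶ A) ∷ (y ∶ B) ∷ Γ) Δ →
          LSPASLD G ((z ∶ A ✱ B) ∷ Γ) Δ
  -✱R   : ∀ {G Γ Δ x y z A B} →
          Fresh x G Γ ((z ∶ A -✱ B) ∷ Δ) → Fresh y G Γ ((z ∶ A -✱ B) ∷ Δ) → ¬ (x ≡ y) →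
          LSPASLD (tern x z y ∷ G) ((x ∶ A) ∷ Γ) ((y ∶ B) ∷ Δ) →
          LSPASLD G Γ ((z ∶ A -✱ B) ∷ Δ)
  ✱R    : ∀ {G Γ Δ x y z w A B} → tern x y z ∈ G → G ⊢E z ≐ w →
          LSPASLD G Γ ((x ∶ A) ∷ (w ∶ A ✱ B) ∷ Δ) →
          LSPASLD G Γ ((y ∶ B) ∷ (w ∶ A ✱ B) ∷ Δ) →
          LSPASLD G Γ ((w ∶ A ✱ B) ∷ Δ)
  -✱L   : ∀ {G Γ Δ x y z w A B} → tern x w y ∈ G → G ⊢E z ≐ w →
          LSPASLD G ((z ∶ A -✱ B) ∷ Γ) ((x ∶ A) ∷ Δ) →
          LSPASLD G ((z ∶ A -✱ B) ∷ (y ∶ B) ∷ Γ) Δ →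
          LSPASLD G ((z ∶ A -✱ B) ∷ Γ) Δ
  EM    : ∀ {G Γ Δ} a b → LSPASLD (eqₐ a b ∷ G) Γ Δ → LSPASLD (neqₐ a b ∷ G) Γ Δ →
          LSPASLD G Γ Δ
  -- structural rules synthesised from the frame axioms of PASL
  Eq₁   : ∀ {G Γ Δ x y z} → tern x y z ∈ G → G ⊢E y ≐ ε →
          LSPASLD (eqₐ x z ∷ G) Γ Δ → LSPASLD G Γ Δ
  U     : ∀ {G Γ Δ} x → LSPASLD (tern x ε x ∷ G) Γ Δ → LSPASLD G Γ Δ
  Com   : ∀ {G Γ Δ x y z} → tern x y z ∈ G →
          LSPASLD (tern y x z ∷ G) Γ Δ → LSPASLD G Γ Δ
  A     : ∀ {G Γ Δ u v w x y y' b} → tern u y x ∈ G → tern v w y' ∈ G → G ⊢E y ≐ y' →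
          Fresh b G Γ Δ →
          LSPASLD (tern b w x ∷ tern u v b ∷ G) Γ Δ → LSPASLD G Γ Δ
  P     : ∀ {G Γ Δ w w' x x' y z} → tern w x y ∈ G → tern w' x' z ∈ G →
          G ⊢E w ≐ w' → G ⊢E x ≐ x' →
          LSPASLD (eqₐ y z ∷ G) Γ Δ → LSPASLD G Γ Δ
  C     : ∀ {G Γ Δ x x' y z z' w} → tern x y z ∈ G → tern x' w z' ∈ G →
          G ⊢E x ≐ x' → G ⊢E z ≐ z' →
          LSPASLD (eqₐ y w ∷ G) Γ Δ → LSPASLD G Γ Δ
  -- rule D synthesised from disjointness
  D     : ∀ {G Γ Δ x y z} → tern x y z ∈ G → G ⊢E x ≐ y →
          LSPASLD (eqₐ x ε ∷ G) Γ Δ → LSPASLD G Γ Δ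

Provable : Formula → Set
Provable F = ∃ λ w → ¬ (w ≡ ε) × LSPASLD [] [] ((w ∶ F) ∷ [])

module Submission where

-- Read bottom-up, the derivation of  ⊤* ∧ (A ✱ B) ⇒ A  at a
-- label w is:  ⇒R, ∧L and ⊤*L reduce it to  w = ε ; w : A ✱ B ⊢ w : A,
-- and ✱L splits w into fresh x, y with  x ∘ y = w = ε.  The heart of the
-- argument is the frame fact "a left factor of ε is ε": from x ∘ y = ε the
-- rules U (x = x ∘ ε), A (associativity gives a fresh b with x ∘ x = b and
-- b ∘ y = x) and D (x ∘ x defined forces x = ε) yield x = ε, hence x = w,
-- and the goal closes by the identity axiom for the arbitrary formula A.

open import Defs
open import Data.Nat using (ℕ; suc; _+_; _≤_)
open import Data.Nat.Properties using (m≤m+n; m≤n+m; ≤-trans; 1+n≰n; 1+n≢n)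
open import Data.Nat.ListAction using (sum)
open import Data.List using (List; _∷_)
open import Data.List.Relation.Unary.Any using (here; there)
open import Data.List.Membership.Propositional using (_∈_)
open import Data.List.Relation.Binary.Subset.Propositional using (_⊆_)
open import Data.List.Relation.Binary.Subset.Propositional.Properties
  using (⊆-refl; ⊆-trans; xs⊆x∷xs)
open import Data.Product using (_,_)
open import Relation.Nullary using (¬_)
open import Relation.Binary.PropositionalEquality using (_≡_; refl; sym)

E-mono : ∀ {G G' a b} → G ⊆ G' → G ⊢E a ≐ b → G' ⊢E a ≐ b
E-mono G⊆G' (e-base p)    = e-base (G⊆G' p)
E-mono G⊆G' e-refl        = e-refl
E-mono G⊆G' (e-sym e)     = e-sym (E-mono G⊆G' e)
E-mono G⊆G' (e-trans e f) = e-trans (E-mono G⊆G' e) (E-mono G⊆G' f)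

E-weaken : ∀ {G t a b} → G ⊢E a ≐ b → (t ∷ G) ⊢E a ≐ b
E-weaken {G} {t} = E-mono (xs⊆x∷xs G t)

swap-⊆ : ∀ {X : Set} {x y : X} {xs : List X} → (x ∷ y ∷ xs) ⊆ (y ∷ x ∷ xs)
swap-⊆ (here p)          = there (here p)
swap-⊆ (there (here p))  = here p
swap-⊆ (there (there p)) = there (there p)

exchangeL : ∀ {G Γ Δ φ ψ} → LSPASLD G (φ ∷ ψ ∷ Γ) Δ → LSPASLD G (ψ ∷ φ ∷ Γ) Δ
exchangeL = set-ext (⊆-refl , ⊆-refl) (swap-⊆ , swap-⊆) (⊆-refl , ⊆-refl)

∈⇒≤sum : ∀ {n ns} → n ∈ ns → n ≤ sum ns
∈⇒≤sum {ns = m ∷ ms} (here refl) = m≤m+n m (sum ms)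
∈⇒≤sum {ns = m ∷ ms} (there p)   = ≤-trans (∈⇒≤sum p) (m≤n+m (sum ms) m)

freshLabel : ℕ → List RelAtom → List LFormula → List LFormula → Label
freshLabel k G Γ Δ = suc (k + sum (seqLabels G Γ Δ))

freshLabel-fresh : ∀ k G Γ Δ → Fresh (freshLabel k G Γ Δ) G Γ Δ
freshLabel-fresh k G Γ Δ =
  (λ p → 1+n≰n (≤-trans (∈⇒≤sum p) (m≤n+m _ k))) , λ ()

freshLabel-distinct : ∀ G Γ Δ → ¬ (freshLabel 0 G Γ Δ ≡ freshLabel 1 G Γ Δ)
freshLabel-distinct G Γ Δ eq = 1+n≢n (sym eq)

-- Generalised identity axiom: a : F ⊢ b : F whenever E(G) ⊢ a = b, for
-- every formula F (by induction on F; the axiom (id) covers only atoms).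
identity : ∀ F {G Γ Δ a b} → G ⊢E a ≐ b → LSPASLD G ((a ∶ F) ∷ Γ) ((b ∶ F) ∷ Δ)
identity (var p) a≐b = id a≐b
identity ⊤ᶠ      a≐b = ⊤R
identity ⊥ᶠ      a≐b = ⊥L
identity ⊤*      a≐b = ⊤*L (⊤*R (e-trans (e-sym (E-weaken a≐b)) (e-base (here refl))))
identity (F ∧ᶠ H) a≐b = ∧L (∧R (identity F a≐b) (exchangeL (identity H a≐b)))
identity (F ⇒ H)  a≐b = ⇒R (exchangeL (⇒L (identity F (e-sym a≐b)) (identity H a≐b)))
identity (F ✱ H) {G} {Γ} {Δ} {a} {b} a≐b =
  ✱L (freshLabel-fresh 0 G Γ' Δ') (freshLabel-fresh 1 G Γ' Δ') (freshLabel-distinct G Γ' Δ')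
     (✱R (here refl) (E-weaken a≐b) (identity F e-refl) (exchangeL (identity H e-refl)))
  where
  Γ' : List LFormula
  Γ' = (a ∶ F ✱ H) ∷ Γ
  Δ' : List LFormula
  Δ' = (b ∶ F ✱ H) ∷ Δ
identity (F -✱ H) {G} {Γ} {Δ} {a} {b} a≐b =
  -✱R (freshLabel-fresh 0 G Γ' Δ') (freshLabel-fresh 1 G Γ' Δ') (freshLabel-distinct G Γ' Δ')
      (exchangeL (-✱L (here refl) (E-weaken a≐b)
                      (exchangeL (identity F e-refl)) (exchangeL (identity H e-refl))))
  where
  Γ' : List LFormula
  Γ' = (a ∶ F -✱ H) ∷ Γ
  Δ' : List LFormula
  Δ' = (b ∶ F -✱ H) ∷ Δ

-- The premise is required for every extension G'
-- of G in which x = ε holds, since the derivation adds auxiliary atoms.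
leftFactorOfUnit : ∀ {G Γ Δ x y z} → tern x y z ∈ G → G ⊢E z ≐ ε →
                   (∀ {G'} → G ⊆ G' → G' ⊢E x ≐ ε → LSPASLD G' Γ Δ) →
                   LSPASLD G Γ Δ
leftFactorOfUnit {G} {Γ} {Δ} {x} xy▷z z≐ε continue =
  U x                                                    -- x ∘ ε = x
    (A (here refl) (there xy▷z) (e-sym (E-weaken z≐ε))    -- b ∘ y = x, x ∘ x = b
       (freshLabel-fresh 0 (tern x ε x ∷ G) Γ Δ)
       (D (there (here refl)) e-refl                     -- x ∘ x defined, so x = ε
          (continue G⊆G₃ (e-base (here refl)))))
  where
  G⊆G₃ : G ⊆ (_ ∷ _ ∷ _ ∷ tern x ε x ∷ G)
  G⊆G₃ p = there (there (there (there p)))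

-- The theorem at the level of sequents: a world equal to ε that satisfies
-- F ✱ H satisfies F, because both halves of the split equal ε.
unitStarElim : ∀ {G Γ Δ z w F H} → G ⊢E z ≐ ε → G ⊢E z ≐ w →
               LSPASLD G ((z ∶ F ✱ H) ∷ Γ) ((w ∶ F) ∷ Δ)
unitStarElim {G} {Γ} {Δ} {z} {w} {F} {H} z≐ε z≐w =
  ✱L (freshLabel-fresh 0 G Γ' Δ') (freshLabel-fresh 1 G Γ' Δ') (freshLabel-distinct G Γ' Δ')
     (leftFactorOfUnit (here refl) (E-weaken z≐ε) λ G⊆G' x≐ε →
        identity F (e-trans x≐ε (e-sym (E-mono (⊆-trans (xs⊆x∷xs G _) G⊆G') w≐ε))))
  where
  w≐ε : G ⊢E w ≐ ε
  w≐ε = e-trans (e-sym z≐w) z≐ε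
  Γ' : List LFormula
  Γ' = (z ∶ F ✱ H) ∷ Γ
  Δ' : List LFormula
  Δ' = (w ∶ F) ∷ Δ

proposition4p3 : (A B : Formula) → Provable ((⊤* ∧ᶠ (A ✱ B)) ⇒ A)
proposition4p3 F H = 1 , (λ ()) , ⇒R (∧L (⊤*L (unitStarElim (e-base (here refl)) e-refl)))
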